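{- Fix an integer $m\ge2$. For $n\ge0$ let $A^{(m)}_n$ be the number of ways to tile an $n$-board using squares and $(1,m-1)$-fences. Then for all integers $n\ge0$ and $r\in\{0,1,\dots,m-1\}$, \[ A^{(m)}_{mn+r}=f_n^{\,m-r}f_{n+1}^{\,r}, \] where $f_n=F_{n+1}$ and $F_k$ is the $k$th Fibonacci number.
   Context: An $n$-board is a $1\times n$ row of $n$ unit cells. A square is a $1\times1$ tile. A $(1,m-1)$-fence is a tile consisting of two $1\times1$ posts separated by a gap of width $m-1$ cells; placed on a board its posts occupy cells $i$ and $i+m$, and the gap cells are not covered by the fence (they must be covered by other tiles). A tiling covers every cell exactly once; the $0$-board has exactly one tiling. Fibonacci numbers: $F_0=0$, $F_1=1$, $F_k=F_{k-1}+F_{k-2}$. -}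

module Defs where

open import Data.Nat using (ℕ; zero; suc; _+_; _*_; _∸_; _^_; _<_; _≤_)
open import Data.Nat.Properties using (_<?_; _≤?_)
open import Data.Fin.Properties using (all?)
open import Data.Fin using (Fin; toℕ)
open import Data.Vec using (Vec; []; _∷_; lookup)
open import Data.List using (List; []; _∷_; map; concatMap; length; filter)
open import Data.Product using (_×_; _,_)
open import Relation.Nullary using (Dec; yes; no)
open import Relation.Nullary.Decidable using (_×-dec_; _→-dec_)
open import Relation.Binary.PropositionalEquality using (_≡_; refl)

F : ℕ → ℕ
F zero = 0
F (suc zero) = 1
F (suc (suc k)) = F (suc k) + F k

f : ℕ → ℕ
f n = F (suc n)

-- The role a cell plays in a tiling by squares and (1,m-1)-fences:
-- covered by a square, by the left post of a fence, or by the right post.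
data Role : Set where
  sq lpost rpost : Role

isL : (x : Role) → Dec (x ≡ lpost)
isL sq = no λ ()
isL lpost = yes refl
isL rpost = no λ ()

isR : (x : Role) → Dec (x ≡ rpost)
isR sq = no λ ()
isR lpost = no λ ()
isR rpost = yes refl

-- Role of cell i (cells indexed 0..n-1); cells outside the board are 'sq'
-- (only used to state that posts must lie on the board, see ValidTiling).
roleAt : ∀ {n} → Vec Role n → ℕ → Role
roleAt [] i = sq
roleAt (x ∷ v) zero = x
roleAt (x ∷ v) (suc i) = roleAt v i

-- A labelling of the cells of an n-board is a tiling by squares and
-- (1,m-1)-fences iff (a fence with posts at cells i and i+m):
--  * every left post at cell i has i+m < n and a right post at cell i+m;
--  * every right post at cell j = i+m has a left post at cell i = j-m (j ≥ m).
-- A tiling (set of tiles covering each cell exactly once) corresponds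
-- bijectively to such a labelling: every cell is covered by exactly one tile,
-- and the tile is recovered from the label (fences pair cell i with i+m).
ValidTiling : (m n : ℕ) → Vec Role n → Set
ValidTiling m n v = (i : Fin n) →
  ((lookup v i ≡ lpost) → (toℕ i + m < n) × (roleAt v (toℕ i + m) ≡ rpost))
  × ((lookup v i ≡ rpost) → (m ≤ toℕ i) × (roleAt v (toℕ i ∸ m) ≡ lpost))

allLabellings : (n : ℕ) → List (Vec Role n)
allLabellings zero = [] ∷ []
allLabellings (suc n) =
  concatMap (λ v → (sq ∷ v) ∷ (lpost ∷ v) ∷ (rpost ∷ v) ∷ []) (allLabellings n)

validTiling? : (m n : ℕ) (v : Vec Role n) → Dec (ValidTiling m n v)
validTiling? m n v = all? λ i →
  (isL (lookup v i) →-dec ((toℕ i + m <? n) ×-dec isR (roleAt v (toℕ i + m))))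
  ×-dec
  (isR (lookup v i) →-dec ((m ≤? toℕ i) ×-dec isL (roleAt v (toℕ i ∸ m))))

A : (m n : ℕ) → ℕ
A m n = length (filter (validTiling? m n) (allLabellings n))

-- A labelling
-- is a tiling iff no right post lies among the first m cells and cell j + m is
-- a right post exactly when cell j is a left post.  Hence, reading left to
-- right, one only has to remember which of the next m cells are forced to be
-- right posts: a window S ∈ Bool^m, shifted by one at each cell.  The cells
-- congruent to j modulo m form a chain of length ℓⱼ on which fences act as
-- dominoes, so the labellings accepted from window S number the product over j
-- of F (ℓⱼ + 1) or F ℓⱼ, according as cell j is free or forced.  For
-- n = m q + r, r chains have length q + 1 and the other m − r have length q.
module Submission where

open import Defs
open import Data.Bool using (Bool; true; false; not; _∧_; T; T?)
open import Data.Bool.Properties using (⇔→≡; ¬-not)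
open import Data.Fin using (Fin; toℕ; fromℕ<)
import Data.Fin as Fin
open import Data.Fin.Properties using (toℕ-fromℕ<)
open import Data.List using (List; []; _∷_; concatMap; length; filter)
open import Data.List.Properties using (filter-≐)
open import Data.Nat using (ℕ; zero; suc; _+_; _*_; _∸_; _^_; _<_; _≤_; z≤n; s≤s; z<s; s<s)
open import Data.Nat.Properties
open import Data.Nat.Tactic.RingSolver using (solve-∀)
open import Data.Product using (∃-syntax; _×_; _,_; proj₁; proj₂)
open import Data.Product.Function.NonDependent.Propositional using (_×-⇔_)
open import Data.Sum using (_⊎_; inj₁; inj₂)
open import Data.Unit using (tt)
open import Data.Vec using (Vec; []; _∷_; lookup; replicate; _∷ʳ_)
open import Function using (_∘_; _⇔_; mk⇔; Equivalence)
import Function.Properties.Equivalence as ⇔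
open import Relation.Nullary using (yes; no; contradiction)
open import Relation.Binary.PropositionalEquality

open Equivalence using (to; from)

private
  variable
    k n : ℕ

isLpost isRpost : Role → Bool
isLpost lpost = true
isLpost _     = false
isRpost rpost = true
isRpost _     = false

isLpost≡true⇔ : ∀ {x} → isLpost x ≡ true ⇔ x ≡ lpost
isLpost≡true⇔ {sq}    = mk⇔ (λ ()) (λ ())
isLpost≡true⇔ {lpost} = mk⇔ (λ _ → refl) (λ _ → refl)
isLpost≡true⇔ {rpost} = mk⇔ (λ ()) (λ ())

isRpost≡true⇔ : ∀ {x} → isRpost x ≡ true ⇔ x ≡ rpost
isRpost≡true⇔ {sq}    = mk⇔ (λ ()) (λ ())
isRpost≡true⇔ {lpost} = mk⇔ (λ ()) (λ ())
isRpost≡true⇔ {rpost} = mk⇔ (λ _ → refl) (λ _ → refl)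

lpostAt rpostAt : Vec Role n → ℕ → Bool
lpostAt v i = isLpost (roleAt v i)
rpostAt v i = isRpost (roleAt v i)

lpost≢sq : lpost ≢ sq
lpost≢sq ()

rpost≢sq : rpost ≢ sq
rpost≢sq ()

roleAt≢sq⇒< : (v : Vec Role n) (i : ℕ) → roleAt v i ≢ sq → i < n
roleAt≢sq⇒< []      i       ne = contradiction refl ne
roleAt≢sq⇒< (x ∷ v) zero    ne = z<s
roleAt≢sq⇒< (x ∷ v) (suc i) ne = s<s (roleAt≢sq⇒< v i ne)

lookup≡roleAt : (v : Vec Role n) (j : Fin n) → lookup v j ≡ roleAt v (toℕ j)
lookup≡roleAt (x ∷ v) Fin.zero    = refl
lookup≡roleAt (x ∷ v) (Fin.suc j) = lookup≡roleAt v j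

<⊎≡+ : ∀ m i → i < m ⊎ ∃[ j ] i ≡ m + j
<⊎≡+ m i with i <? m
... | yes i<m = inj₁ i<m
... | no  i≮m = inj₂ (i ∸ m , sym (m+[n∸m]≡n (≮⇒≥ i≮m)))

prepend : ∀ {A : Set} → Vec A k → (ℕ → A) → ℕ → A
prepend []       g i       = g i
prepend (x ∷ xs) g zero    = x
prepend (x ∷ xs) g (suc i) = prepend xs g i

prepend-∷ʳ : ∀ {A : Set} (xs : Vec A k) (g : ℕ → A) i →
             prepend (xs ∷ʳ g 0) (g ∘ suc) i ≡ prepend xs g i
prepend-∷ʳ []       g zero    = refl
prepend-∷ʳ []       g (suc i) = refl
prepend-∷ʳ (x ∷ xs) g zero    = refl
prepend-∷ʳ (x ∷ xs) g (suc i) = prepend-∷ʳ xs g i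

prepend-+ : ∀ {A : Set} (xs : Vec A k) (g : ℕ → A) j → prepend xs g (k + j) ≡ g j
prepend-+ []       g j = refl
prepend-+ (x ∷ xs) g j = prepend-+ xs g j

prepend-replicate-< : ∀ {A : Set} {x : A} {g : ℕ → A} {i} → i < k →
                      prepend (replicate k x) g i ≡ x
prepend-replicate-< {i = zero}  (s≤s _)   = refl
prepend-replicate-< {i = suc i} (s≤s i<k) = prepend-replicate-< i<k

prepend-replicate⇔ : ∀ {A : Set} m (x : A) (g h : ℕ → A) →
  (∀ i → h i ≡ prepend (replicate m x) g i) ⇔
  ((∀ i → i < m → h i ≡ x) × (∀ j → h (m + j) ≡ g j))
prepend-replicate⇔ m x g h = mk⇔
  (λ eq → (λ i i<m → trans (eq i) (prepend-replicate-< i<m))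
        , (λ j → trans (eq (m + j)) (prepend-+ (replicate m x) g j)))
  (λ (below , above) i → split below above i (<⊎≡+ m i))
  where
  split : (∀ i → i < m → h i ≡ x) → (∀ j → h (m + j) ≡ g j) →
          ∀ i → i < m ⊎ ∃[ j ] i ≡ m + j → h i ≡ prepend (replicate m x) g i
  split below above i (inj₁ i<m)        = trans (below i i<m) (sym (prepend-replicate-< i<m))
  split below above _ (inj₂ (j , refl)) = trans (above j) (sym (prepend-+ (replicate m x) g j))

ValidAt : ℕ → Vec Role n → ℕ → Set
ValidAt m v i = (roleAt v i ≡ lpost → roleAt v (i + m) ≡ rpost)
              × (roleAt v i ≡ rpost → m ≤ i × roleAt v (i ∸ m) ≡ lpost)

validAt-toℕ : ∀ {m} {v : Vec Role n} → ValidTiling m n v → ∀ j → ValidAt m v (toℕ j)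
validAt-toℕ {v = v} vt j = proj₂ ∘ proj₁ (vt j) ∘ trans (lookup≡roleAt v j)
                         , proj₂ (vt j) ∘ trans (lookup≡roleAt v j)

validTiling⇔validAt : ∀ m (v : Vec Role n) → ValidTiling m n v ⇔ (∀ i → ValidAt m v i)
validTiling⇔validAt m v = mk⇔
  (λ vt i → (λ e → proj₁ (validAtPost vt e lpost≢sq) e) , (λ e → proj₂ (validAtPost vt e rpost≢sq) e))
  (λ va j → (λ e → let r = proj₁ (va (toℕ j)) (trans (sym (lookup≡roleAt v j)) e)
                   in roleAt≢sq⇒< v _ (rpost≢sq ∘ trans (sym r)) , r)
          , proj₂ (va (toℕ j)) ∘ trans (sym (lookup≡roleAt v j)))
  where
  validAtPost : ValidTiling m _ v → ∀ {i x} → roleAt v i ≡ x → x ≢ sq → ValidAt m v i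
  validAtPost vt {i} e x≢sq = subst (ValidAt m v) (toℕ-fromℕ< i<n) (validAt-toℕ {v = v} vt (fromℕ< i<n))
    where i<n = roleAt≢sq⇒< v i (x≢sq ∘ trans (sym e))

validAt⇔ : ∀ m (v : Vec Role n) → (∀ i → ValidAt m v i) ⇔
  ((∀ i → i < m → rpostAt v i ≡ false) × (∀ j → rpostAt v (m + j) ≡ lpostAt v j))
validAt⇔ m v = mk⇔
  (λ va → (λ i i<m → ¬-not (λ r → <⇒≱ i<m (proj₁ (proj₂ (va i) (to isRpost≡true⇔ r)))))
        , (λ j → ⇔→≡ (mk⇔ (rightPost⇒leftPost va j) (leftPost⇒rightPost va j))))
  (λ (below , above) i → atLpost above i , atRpost below above i (<⊎≡+ m i))
  where
  rightPost⇒leftPost : (∀ i → ValidAt m v i) → ∀ j → rpostAt v (m + j) ≡ true → lpostAt v j ≡ true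
  rightPost⇒leftPost va j r = from isLpost≡true⇔
    (subst (λ t → roleAt v t ≡ lpost) (m+n∸m≡n m j) (proj₂ (proj₂ (va (m + j)) (to isRpost≡true⇔ r))))
  leftPost⇒rightPost : (∀ i → ValidAt m v i) → ∀ j → lpostAt v j ≡ true → rpostAt v (m + j) ≡ true
  leftPost⇒rightPost va j l = from isRpost≡true⇔
    (subst (λ t → roleAt v t ≡ rpost) (+-comm j m) (proj₁ (va j) (to isLpost≡true⇔ l)))
  atLpost : (∀ j → rpostAt v (m + j) ≡ lpostAt v j) →
            ∀ i → roleAt v i ≡ lpost → roleAt v (i + m) ≡ rpost
  atLpost above i e = subst (λ t → roleAt v t ≡ rpost) (+-comm m i)
    (to isRpost≡true⇔ (trans (above i) (from isLpost≡true⇔ e)))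
  atRpost : (∀ i → i < m → rpostAt v i ≡ false) → (∀ j → rpostAt v (m + j) ≡ lpostAt v j) →
            ∀ i → i < m ⊎ ∃[ j ] i ≡ m + j →
            roleAt v i ≡ rpost → m ≤ i × roleAt v (i ∸ m) ≡ lpost
  atRpost below above i (inj₁ i<m) e =
    contradiction (trans (sym (from isRpost≡true⇔ e)) (below i i<m)) λ ()
  atRpost below above _ (inj₂ (j , refl)) e = m≤m+n m j ,
    subst (λ t → roleAt v t ≡ lpost) (sym (m+n∸m≡n m j))
      (to isLpost≡true⇔ (trans (sym (above j)) (from isRpost≡true⇔ e)))

-- S marks the cells forced to be right posts by fences whose left post lies
-- before the board.
Fenced : Vec Bool k → Vec Role n → Set
Fenced S v = ∀ i → rpostAt v i ≡ prepend S (lpostAt v) i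

validTiling⇔fenced : ∀ m (v : Vec Role n) → ValidTiling m n v ⇔ Fenced (replicate m false) v
validTiling⇔fenced m v =
  ⇔.trans (validTiling⇔validAt m v)
  (⇔.trans (validAt⇔ m v) (⇔.sym (prepend-replicate⇔ m false (lpostAt v) (rpostAt v))))

noPending : Vec Bool k → Bool
noPending []      = true
noPending (b ∷ S) = not b ∧ noPending S

fenced-[]⇔ : (S : Vec Bool k) → Fenced S [] ⇔ T (noPending S)
fenced-[]⇔ []          = mk⇔ (λ _ → tt) (λ _ _ → refl)
fenced-[]⇔ (false ∷ S) = mk⇔ (λ h → to (fenced-[]⇔ S) (h ∘ suc))
                              (λ t → λ { zero → refl ; (suc i) → from (fenced-[]⇔ S) t i })
fenced-[]⇔ (true ∷ S)  = mk⇔ (λ h → contradiction (h 0) λ ()) λ ()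

fenced-∷⇔ : ∀ b (S : Vec Bool k) x (w : Vec Role n) →
            Fenced (b ∷ S) (x ∷ w) ⇔ (isRpost x ≡ b × Fenced (S ∷ʳ isLpost x) w)
fenced-∷⇔ b S x w = mk⇔
  (λ h → h 0 , λ i → trans (h (suc i)) (sym (prepend-∷ʳ S (lpostAt (x ∷ w)) i)))
  (λ { (e , h) zero → e ; (e , h) (suc i) → trans (h i) (prepend-∷ʳ S (lpostAt (x ∷ w)) i) })

accepts : Vec Bool (suc k) → Vec Role n → Bool
accepts S           []          = noPending S
accepts (false ∷ S) (sq ∷ w)    = accepts (S ∷ʳ false) w
accepts (false ∷ S) (lpost ∷ w) = accepts (S ∷ʳ true) w
accepts (false ∷ S) (rpost ∷ w) = false
accepts (true ∷ S)  (sq ∷ w)    = false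
accepts (true ∷ S)  (lpost ∷ w) = false
accepts (true ∷ S)  (rpost ∷ w) = accepts (S ∷ʳ false) w

accepts-∷⇔ : ∀ b (S : Vec Bool k) x (w : Vec Role n) →
             T (accepts (b ∷ S) (x ∷ w)) ⇔ (isRpost x ≡ b × T (accepts (S ∷ʳ isLpost x) w))
accepts-∷⇔ false S sq    w = mk⇔ (refl ,_) proj₂
accepts-∷⇔ false S lpost w = mk⇔ (refl ,_) proj₂
accepts-∷⇔ false S rpost w = mk⇔ (λ ()) λ { (() , _) }
accepts-∷⇔ true  S sq    w = mk⇔ (λ ()) λ { (() , _) }
accepts-∷⇔ true  S lpost w = mk⇔ (λ ()) λ { (() , _) }
accepts-∷⇔ true  S rpost w = mk⇔ (refl ,_) proj₂

fenced⇔accepts : (S : Vec Bool (suc k)) (v : Vec Role n) → Fenced S v ⇔ T (accepts S v)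
fenced⇔accepts S       []      = fenced-[]⇔ S
fenced⇔accepts (b ∷ S) (x ∷ w) =
  ⇔.trans (fenced-∷⇔ b S x w)
  (⇔.trans (⇔.refl ×-⇔ fenced⇔accepts (S ∷ʳ isLpost x) w) (⇔.sym (accepts-∷⇔ b S x w)))

indicator : Bool → ℕ
indicator true  = 1
indicator false = 0

count : ∀ {A : Set} → (A → Bool) → List A → ℕ
count p []       = 0
count p (x ∷ xs) = indicator (p x) + count p xs

length-filter-T? : ∀ {A : Set} (p : A → Bool) xs → length (filter (T? ∘ p) xs) ≡ count p xs
length-filter-T? p []       = refl
length-filter-T? p (x ∷ xs) with p x
... | true  = cong suc (length-filter-T? p xs)
... | false = length-filter-T? p xs

count-false : ∀ {A : Set} (xs : List A) → count (λ _ → false) xs ≡ 0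
count-false []       = refl
count-false (x ∷ xs) = count-false xs

count-allLabellings-suc : ∀ n (p : Vec Role (suc n) → Bool) →
  count p (allLabellings (suc n)) ≡
  count (p ∘ (sq ∷_)) (allLabellings n) + count (p ∘ (lpost ∷_)) (allLabellings n)
  + count (p ∘ (rpost ∷_)) (allLabellings n)
count-allLabellings-suc n p = go (allLabellings n)
  where
  go : ∀ vs → count p (concatMap (λ v → (sq ∷ v) ∷ (lpost ∷ v) ∷ (rpost ∷ v) ∷ []) vs) ≡
              count (p ∘ (sq ∷_)) vs + count (p ∘ (lpost ∷_)) vs + count (p ∘ (rpost ∷_)) vs
  go []       = refl
  go (v ∷ vs) = trans (cong (λ t → a + (b + (c + t))) (go vs))
                      (interchange a b c (count (p ∘ (sq ∷_)) vs)
                                         (count (p ∘ (lpost ∷_)) vs) (count (p ∘ (rpost ∷_)) vs))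
    where
    a = indicator (p (sq ∷ v))
    b = indicator (p (lpost ∷ v))
    c = indicator (p (rpost ∷ v))
    interchange : ∀ a b c x y z → a + (b + (c + (x + y + z))) ≡ (a + x) + (b + y) + (c + z)
    interchange = solve-∀

countAccepted : ℕ → Vec Bool (suc k) → ℕ
countAccepted n S = count (accepts S) (allLabellings n)

countAccepted-suc-false : ∀ n (S : Vec Bool k) →
  countAccepted (suc n) (false ∷ S) ≡ countAccepted n (S ∷ʳ false) + countAccepted n (S ∷ʳ true)
countAccepted-suc-false n S = begin
  countAccepted (suc n) (false ∷ S)
    ≡⟨ count-allLabellings-suc n (accepts (false ∷ S)) ⟩
  countAccepted n (S ∷ʳ false) + countAccepted n (S ∷ʳ true) + count (λ _ → false) (allLabellings n)
    ≡⟨ cong (countAccepted n (S ∷ʳ false) + countAccepted n (S ∷ʳ true) +_) (count-false (allLabellings n)) ⟩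
  countAccepted n (S ∷ʳ false) + countAccepted n (S ∷ʳ true) + 0
    ≡⟨ +-identityʳ _ ⟩
  countAccepted n (S ∷ʳ false) + countAccepted n (S ∷ʳ true) ∎
  where open ≡-Reasoning

countAccepted-suc-true : ∀ n (S : Vec Bool k) →
  countAccepted (suc n) (true ∷ S) ≡ countAccepted n (S ∷ʳ false)
countAccepted-suc-true n S =
  trans (count-allLabellings-suc n (accepts (true ∷ S)))
        (cong₂ (λ x y → x + y + countAccepted n (S ∷ʳ false))
               (count-false (allLabellings n)) (count-false (allLabellings n)))

-- Tilings of a chain of ℓ cells whose first cell is free (false) or is forced
-- to be a right post (true).
chainTilings : ℕ → Bool → ℕ
chainTilings ℓ false = f ℓ
chainTilings ℓ true  = F ℓ

windowTilings : Vec ℕ k → Vec Bool k → ℕ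
windowTilings []       []      = 1
windowTilings (ℓ ∷ Ls) (b ∷ S) = chainTilings ℓ b * windowTilings Ls S

windowTilings-∷ʳ : (Ls : Vec ℕ k) (S : Vec Bool k) (ℓ : ℕ) (b : Bool) →
  windowTilings (Ls ∷ʳ ℓ) (S ∷ʳ b) ≡ windowTilings Ls S * chainTilings ℓ b
windowTilings-∷ʳ []        []      ℓ b = *-comm (chainTilings ℓ b) 1
windowTilings-∷ʳ (ℓ′ ∷ Ls) (s ∷ S) ℓ b =
  trans (cong (chainTilings ℓ′ s *_) (windowTilings-∷ʳ Ls S ℓ b))
        (sym (*-assoc (chainTilings ℓ′ s) _ _))

windowTilings-zeros : (S : Vec Bool k) → windowTilings (replicate k 0) S ≡ indicator (noPending S)
windowTilings-zeros []          = refl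
windowTilings-zeros (false ∷ S) = trans (+-identityʳ _) (windowTilings-zeros S)
windowTilings-zeros (true ∷ S)  = refl

CountedBy : ℕ → Vec ℕ (suc k) → Set
CountedBy n Ls = ∀ S → countAccepted n S ≡ windowTilings Ls S

countedBy-zero : CountedBy 0 (replicate (suc k) 0)
countedBy-zero S = trans (+-identityʳ _) (sym (windowTilings-zeros S))

countedBy-suc : (Ls : Vec ℕ k) (ℓ : ℕ) → CountedBy n (Ls ∷ʳ ℓ) → CountedBy (suc n) (suc ℓ ∷ Ls)
countedBy-suc {n = n} Ls ℓ counted (false ∷ S) = begin
  countAccepted (suc n) (false ∷ S)
    ≡⟨ countAccepted-suc-false n S ⟩
  countAccepted n (S ∷ʳ false) + countAccepted n (S ∷ʳ true)
    ≡⟨ cong₂ _+_ (counted (S ∷ʳ false)) (counted (S ∷ʳ true)) ⟩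
  windowTilings (Ls ∷ʳ ℓ) (S ∷ʳ false) + windowTilings (Ls ∷ʳ ℓ) (S ∷ʳ true)
    ≡⟨ cong₂ _+_ (windowTilings-∷ʳ Ls S ℓ false) (windowTilings-∷ʳ Ls S ℓ true) ⟩
  windowTilings Ls S * f ℓ + windowTilings Ls S * F ℓ
    ≡⟨ sym (*-distribˡ-+ (windowTilings Ls S) (f ℓ) (F ℓ)) ⟩
  windowTilings Ls S * (f ℓ + F ℓ)
    ≡⟨ *-comm (windowTilings Ls S) _ ⟩
  chainTilings (suc ℓ) false * windowTilings Ls S ∎
  where open ≡-Reasoning
countedBy-suc {n = n} Ls ℓ counted (true ∷ S) = begin
  countAccepted (suc n) (true ∷ S)              ≡⟨ countAccepted-suc-true n S ⟩
  countAccepted n (S ∷ʳ false)                  ≡⟨ counted (S ∷ʳ false) ⟩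
  windowTilings (Ls ∷ʳ ℓ) (S ∷ʳ false)          ≡⟨ windowTilings-∷ʳ Ls S ℓ false ⟩
  windowTilings Ls S * f ℓ                      ≡⟨ *-comm (windowTilings Ls S) _ ⟩
  chainTilings (suc ℓ) true * windowTilings Ls S ∎
  where open ≡-Reasoning

-- Entry j is the number of cells congruent to j modulo k among the first
-- k q + r cells (for r ≤ k): the first r classes have one more cell.
classLengths : (k r q : ℕ) → Vec ℕ k
classLengths zero    r       q = []
classLengths (suc k) zero    q = q ∷ classLengths k zero q
classLengths (suc k) (suc r) q = suc q ∷ classLengths k r q

classLengths-zeros : ∀ k → classLengths k 0 0 ≡ replicate k 0
classLengths-zeros zero    = refl
classLengths-zeros (suc k) = cong (0 ∷_) (classLengths-zeros k)

classLengths-full : ∀ k q → classLengths k k q ≡ classLengths k 0 (suc q)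
classLengths-full zero    q = refl
classLengths-full (suc k) q = cong (suc q ∷_) (classLengths-full k q)

classLengths-∷ʳ : ∀ {k r} q → r ≤ k → classLengths (suc k) r q ≡ classLengths k r q ∷ʳ q
classLengths-∷ʳ {zero}  {zero}  q z≤n     = refl
classLengths-∷ʳ {suc k} {zero}  q z≤n     = cong (q ∷_) (classLengths-∷ʳ q z≤n)
classLengths-∷ʳ {suc k} {suc r} q (s≤s r≤k) = cong (suc q ∷_) (classLengths-∷ʳ q r≤k)

countedBy-classLengths : ∀ k q r → r ≤ suc k → CountedBy (suc k * q + r) (classLengths (suc k) r q)
countedBy-classLengths k zero zero _ =
  subst₂ CountedBy (sym (trans (+-identityʳ _) (*-zeroʳ (suc k)))) (sym (classLengths-zeros (suc k)))
         countedBy-zero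
countedBy-classLengths k (suc q) zero _ =
  subst₂ CountedBy (trans (+-comm (suc k * q) (suc k)) (sym (trans (+-identityʳ _) (*-suc (suc k) q))))
         (classLengths-full (suc k) q)
         (countedBy-classLengths k q (suc k) ≤-refl)
countedBy-classLengths k q (suc r) (s≤s r≤k) =
  subst (λ n → CountedBy n (classLengths (suc k) (suc r) q)) (sym (+-suc (suc k * q) r))
    (countedBy-suc {n = suc k * q + r} (classLengths k r q) q
      (subst (CountedBy (suc k * q + r)) (classLengths-∷ʳ q r≤k)
        (countedBy-classLengths k q r (m≤n⇒m≤1+n r≤k))))

windowTilings-classLengths : ∀ k r q → r ≤ k →
  windowTilings (classLengths k r q) (replicate k false) ≡ f (suc q) ^ r * f q ^ (k ∸ r)
windowTilings-classLengths zero    zero    q z≤n       = refl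
windowTilings-classLengths (suc k) zero    q z≤n       =
  trans (cong (f q *_) (trans (windowTilings-classLengths k 0 q z≤n) (*-identityˡ _)))
        (sym (*-identityˡ _))
windowTilings-classLengths (suc k) (suc r) q (s≤s r≤k) =
  trans (cong (f (suc q) *_) (windowTilings-classLengths k r q r≤k))
        (sym (*-assoc (f (suc q)) _ _))

tilings≡countAccepted : ∀ k n → A (suc k) n ≡ countAccepted n (replicate (suc k) false)
tilings≡countAccepted k n =
  trans (cong length (filter-≐ (validTiling? (suc k) n) (T? ∘ accepts S)
                               ((λ {v} → to (validTiling⇔accepts v)) , (λ {v} → from (validTiling⇔accepts v)))
                               (allLabellings n)))
        (length-filter-T? (accepts S) (allLabellings n))
  where
  S = replicate (suc k) false
  validTiling⇔accepts : (v : Vec Role n) → ValidTiling (suc k) n v ⇔ T (accepts S v)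
  validTiling⇔accepts v = ⇔.trans (validTiling⇔fenced (suc k) v) (fenced⇔accepts S v)

theorem2p4 : (m : ℕ) → 2 ≤ m → (n r : ℕ) → r < m →
    A m (m * n + r) ≡ f n ^ (m ∸ r) * f (n + 1) ^ r
theorem2p4 zero    ()
theorem2p4 (suc k) _ n r (s≤s r≤k) = begin
  A (suc k) (suc k * n + r)
    ≡⟨ tilings≡countAccepted k (suc k * n + r) ⟩
  countAccepted (suc k * n + r) (replicate (suc k) false)
    ≡⟨ countedBy-classLengths k n r (m≤n⇒m≤1+n r≤k) (replicate (suc k) false) ⟩
  windowTilings (classLengths (suc k) r n) (replicate (suc k) false)
    ≡⟨ windowTilings-classLengths (suc k) r n (m≤n⇒m≤1+n r≤k) ⟩
  f (suc n) ^ r * f n ^ (suc k ∸ r)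
    ≡⟨ *-comm (f (suc n) ^ r) _ ⟩
  f n ^ (suc k ∸ r) * f (suc n) ^ r
    ≡⟨ cong (λ t → f n ^ (suc k ∸ r) * f t ^ r) (+-comm 1 n) ⟩
  f n ^ (suc k ∸ r) * f (n + 1) ^ r ∎
  where open ≡-Reasoning
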